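{- Let $T$ be a tournament on $n\ge 5$ vertices. Then there are two Hamilton paths $P=v_1\dots v_n$ and $P'=u_1\dots u_n$ of $T$ with $u_1=v_1$ such that $v_i\to v_{i+1}$ for all $i\in[n-1]$, and there is exactly one $j\in[n-1]$ with $u_{j+1}\to u_j$, while $u_i\to u_{i+1}$ for all $i\in[n-1]\setminus\{j\}$. -}

module Defs where

open import Data.Nat using (ℕ)
open import Data.Fin using (Fin)
open import Data.Product using (_×_)
open import Data.Sum using (_⊎_)
open import Relation.Binary.PropositionalEquality using (_≡_)
open import Relation.Nullary using (¬_)
open import Function.Definitions using (Injective)
open import Level using (0ℓ)
open import Relation.Binary.Core using (Rel)

record Tournament (n : ℕ) : Set₁ where
  field
    E        : Rel (Fin n) 0ℓ
    irrefl   : ∀ x → ¬ E x x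
    total    : ∀ x y → ¬ x ≡ y → E x y ⊎ E y x
    antisym  : ∀ x y → E x y → ¬ E y x

-- A Hamilton path (as a vertex sequence) of a graph on n vertices is an
-- ordering of all vertices: an injective (hence bijective) map Fin n → Fin n.
-- The orientation constraints on consecutive vertices are stated separately.
IsVertexOrdering : ∀ {n} → (Fin n → Fin n) → Set
IsVertexOrdering p = Injective _≡_ _≡_ p

{-# OPTIONS --safe #-}
module Submission where

-- Inserting the vertices one at a time (Rédei) gives a Hamilton path P. For n ≥ 6, P' keeps
-- P except on its last six vertices a₀ → ⋯ → a₅, which it reorders: depending on how the
-- pairs a₃a₅, a₁a₄ and a₀a₅ are oriented, one of a₀a₁a₂a₃a₅a₄, a₀a₁a₄a₅a₃a₂, a₀a₅a₄a₁a₂a₃ and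
-- a₀a₅a₃a₄a₁a₂ has exactly one backward arc. For n = 5 the pairs a₂a₄ and a₀a₃ decide, and
-- if a₄ → a₂ and a₃ → a₀ then P itself must change: P = a₄a₂a₃a₀a₁ and P' = a₄a₃a₀a₁a₂.

open import Data.Empty using (⊥)
open import Data.Fin.Base using (Fin; zero; inject₁; punchIn; punchOut; lift) renaming (suc to fsuc)
open import Data.Fin.Patterns using (0F; 1F; 2F; 3F; 4F; 5F)
open import Data.Fin.Permutation as Perm
  using (Permutation; Permutation′; _⟨$⟩ʳ_; insert; insert-punchIn)
open import Data.Fin.Properties
  using (_≟_; all?; punchIn-punchOut; suc-injective; 0≢1+n; lift-injective)
open import Data.Nat.Base using (ℕ; zero; suc; _+_; _≤_; z≤n; s≤s)
open import Data.Product using (Σ-syntax; ∃-syntax; _×_; _,_)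
open import Data.Sum using (_⊎_; inj₁; inj₂)
open import Data.Unit using (⊤; tt)
open import Data.Vec.Functional using (Vector; insertAt; map; _∷_; [])
open import Data.Vec.Functional.Properties using (insertAt-lookup; insertAt-punchIn)
open import Function.Base using (id; _∘_)
open import Function.Bundles using (Injection)
open import Function.Definitions using (Injective)
open import Function.Properties.Inverse using (↔⇒↣)
open import Level using (0ℓ)
open import Relation.Binary.Core using (Rel)
open import Relation.Binary.PropositionalEquality
  using (_≡_; _≢_; _≗_; refl; sym; trans; cong; subst; subst₂; module ≡-Reasoning)
open import Relation.Nullary.Decidable
  using (Dec; yes; no; map′; True; False; toWitness; toWitnessFalse; _→-dec_)
open import Relation.Nullary.Negation using (¬_; contradiction)
open import Defs

private variable
  m n : ℕ

injective? : (f : Fin m → Fin n) → Dec (Injective _≡_ _≡_ f)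
injective? f = map′ (λ inj {x} {y} → inj x y) (λ inj x y → inj)
  (all? λ x → all? λ y → (f x ≟ f y) →-dec (x ≟ y))

insert≗insertAt : ∀ i j (π : Permutation m n) →
                  (insert i j π ⟨$⟩ʳ_) ≗ insertAt (punchIn j ∘ (π ⟨$⟩ʳ_)) i j
-- Matching on i ≟ k also reduces the test i ≟ k inside insert.
insert≗insertAt i j π k with i ≟ k
... | yes refl = sym (insertAt-lookup _ i j)
... | no i≢k = begin
  punchIn j (π ⟨$⟩ʳ punchOut i≢k)            ≡⟨ insertAt-punchIn _ i j (punchOut i≢k) ⟨
  insertAt _ i j (punchIn i (punchOut i≢k))  ≡⟨ cong (insertAt _ i j) (punchIn-punchOut i≢k) ⟩
  insertAt _ i j k                           ∎
  where open ≡-Reasoning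

map-insertAt : ∀ {A B : Set} (f : A → B) (xs : Vector A n) i x →
               map f (insertAt xs i x) ≗ insertAt (map f xs) i (f x)
map-insertAt             f xs 0F       x 0F       = refl
map-insertAt             f xs 0F       x (fsuc k) = refl
map-insertAt {n = suc n} f xs (fsuc i) x 0F       = refl
map-insertAt {n = suc n} f xs (fsuc i) x (fsuc k) = map-insertAt f (xs ∘ fsuc) i x k

module Semicomplete {V : Set} (_⇒_ : Rel V 0ℓ)
                    (semicomplete : ∀ x y → x ≢ y → x ⇒ y ⊎ y ⇒ x) where

  IsPath : (Fin (suc m) → V) → Set
  IsPath {zero}  g = ⊤
  IsPath {suc m} g = g 0F ⇒ g 1F × IsPath (g ∘ fsuc)

  HasOneBackwardArc : (Fin (suc m) → V) → Set
  HasOneBackwardArc {zero}  g = ⊥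
  HasOneBackwardArc {suc m} g = g 0F ⇒ g 1F × HasOneBackwardArc (g ∘ fsuc)
                              ⊎ g 1F ⇒ g 0F × IsPath (g ∘ fsuc)

  IsPath-resp-≗ : {g h : Fin (suc m) → V} → g ≗ h → IsPath g → IsPath h
  IsPath-resp-≗ {zero}  _   _       = tt
  IsPath-resp-≗ {suc m} g≗h (a , p) =
    subst₂ _⇒_ (g≗h 0F) (g≗h 1F) a , IsPath-resp-≗ (g≗h ∘ fsuc) p

  IsPath⇒forward : (g : Fin (suc m) → V) → IsPath g →
                   ∀ (i : Fin m) → g (inject₁ i) ⇒ g (fsuc i)
  IsPath⇒forward g (a , p) 0F       = a
  IsPath⇒forward g (a , p) (fsuc i) = IsPath⇒forward (g ∘ fsuc) p i

  HasOneBackwardArc⇒backwardOnlyAt : (g : Fin (suc m) → V) → HasOneBackwardArc g →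
    ∃[ j ] (g (fsuc j) ⇒ g (inject₁ j) × (∀ i → i ≢ j → g (inject₁ i) ⇒ g (fsuc i)))
  HasOneBackwardArc⇒backwardOnlyAt {suc m} g (inj₂ (b , p)) = 0F , b , forward
    where
    forward : ∀ i → i ≢ 0F → g (inject₁ i) ⇒ g (fsuc i)
    forward 0F       0≢0 = contradiction refl 0≢0
    forward (fsuc i) _   = IsPath⇒forward (g ∘ fsuc) p i
  HasOneBackwardArc⇒backwardOnlyAt {suc m} g (inj₁ (a , h)) =
    let j , b , forwardElsewhere = HasOneBackwardArc⇒backwardOnlyAt (g ∘ fsuc) h
        forward : ∀ i → i ≢ fsuc j → g (inject₁ i) ⇒ g (fsuc i)
        forward = λ where
          0F       _     → a
          (fsuc i) i≢1+j → forwardElsewhere i (i≢1+j ∘ cong fsuc)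
    in fsuc j , b , forward

  orient : (g : Fin n → V) → Injective _≡_ _≡_ g →
           ∀ i j → {False (i ≟ j)} → g i ⇒ g j ⊎ g j ⇒ g i
  orient g g-inj i j {i≢j} = semicomplete (g i) (g j) (toWitnessFalse i≢j ∘ g-inj)

  insertIntoPath : (w : Fin (suc n) → V) → IsPath w → (x : V) → (∀ i → x ≢ w i) →
                   ∃[ p ] IsPath (insertAt w p x)
  insertIntoPath w path x x∉w with semicomplete x (w 0F) (x∉w 0F)
  ... | inj₁ x⇒w₀ = 0F , x⇒w₀ , path
  insertIntoPath {zero} w _ x _ | inj₂ w₀⇒x = 1F , w₀⇒x , tt
  insertIntoPath {suc n} w (w₀⇒w₁ , path) x x∉w | inj₂ w₀⇒x =
    let p , path′ = insertIntoPath (w ∘ fsuc) path x (x∉w ∘ fsuc)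
    in fsuc p , arcInto p , path′
    where
    arcInto : ∀ p → w 0F ⇒ insertAt (w ∘ fsuc) p x 0F
    arcInto 0F       = w₀⇒x
    arcInto (fsuc _) = w₀⇒w₁

  hamiltonPath : (f : Fin (suc n) → V) → Injective _≡_ _≡_ f →
                 Σ[ σ ∈ Permutation′ (suc n) ] IsPath (f ∘ (σ ⟨$⟩ʳ_))
  hamiltonPath {zero}  f _     = Perm.id , tt
  hamiltonPath {suc n} f f-inj =
    let σ , path  = hamiltonPath (f ∘ fsuc) (λ eq → suc-injective (f-inj eq))
        p , path′ = insertIntoPath (f ∘ fsuc ∘ (σ ⟨$⟩ʳ_)) path (f 0F) (λ _ → 0≢1+n ∘ f-inj)
        reorder : insertAt (f ∘ fsuc ∘ (σ ⟨$⟩ʳ_)) p (f 0F) ≗ f ∘ (insert p 0F σ ⟨$⟩ʳ_)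
        reorder = λ k →
          trans (sym (map-insertAt f _ p 0F k)) (cong f (sym (insert≗insertAt p 0F σ k)))
    in insert p 0F σ , IsPath-resp-≗ reorder path′

  OneBackwardReordering : (Fin (suc m) → V) → Set
  OneBackwardReordering {m} g =
    Σ[ π ∈ (Fin (suc m) → Fin (suc m)) ]
      Injective _≡_ _≡_ π × π 0F ≡ 0F × HasOneBackwardArc (g ∘ π)

  reorderBy : (g : Fin (suc m) → V) (π : Fin (suc m) → Fin (suc m)) →
              {_ : True (injective? π)} → π 0F ≡ 0F → HasOneBackwardArc (g ∘ π) → OneBackwardReordering g
  reorderBy g π {π-inj} π₀≡0 h = π , toWitness π-inj , π₀≡0 , h

  sixVertices : (g : Fin 6 → V) → Injective _≡_ _≡_ g → IsPath g → OneBackwardReordering g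
  sixVertices g g-inj (a01 , a12 , a23 , a34 , a45 , tt)
    with orient g g-inj 3F 5F | orient g g-inj 1F 4F | orient g g-inj 0F 5F
  ... | inj₁ a35 | _        | _        =
    reorderBy g (0F ∷ 1F ∷ 2F ∷ 3F ∷ 5F ∷ 4F ∷ []) refl
      (inj₁ (a01 , inj₁ (a12 , inj₁ (a23 , inj₁ (a35 , inj₂ (a45 , tt))))))
  ... | inj₂ a53 | inj₁ a14 | _        =
    reorderBy g (0F ∷ 1F ∷ 4F ∷ 5F ∷ 3F ∷ 2F ∷ []) refl
      (inj₁ (a01 , inj₁ (a14 , inj₁ (a45 , inj₁ (a53 , inj₂ (a23 , tt))))))
  ... | inj₂ a53 | inj₂ a41 | inj₁ a05 =
    reorderBy g (0F ∷ 5F ∷ 4F ∷ 1F ∷ 2F ∷ 3F ∷ []) refl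
      (inj₁ (a05 , inj₂ (a45 , a41 , a12 , a23 , tt)))
  ... | inj₂ a53 | inj₂ a41 | inj₂ a50 =
    reorderBy g (0F ∷ 5F ∷ 3F ∷ 4F ∷ 1F ∷ 2F ∷ []) refl
      (inj₂ (a50 , a53 , a34 , a41 , a12 , tt))

  oneBackwardReordering : ∀ k (g : Fin (6 + k) → V) → Injective _≡_ _≡_ g → IsPath g →
                          OneBackwardReordering g
  oneBackwardReordering zero    = sixVertices
  oneBackwardReordering (suc k) g g-inj (a01 , path) =
    let π , π-inj , π₀≡0 , h =
          oneBackwardReordering k (g ∘ fsuc) (λ eq → suc-injective (g-inj eq)) path
        a0π₀ = subst (λ i → g 0F ⇒ g (fsuc i)) (sym π₀≡0) a01
    in lift 1 π , lift-injective π π-inj 1 , refl , inj₁ (a0π₀ , h)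

  PathPair : ℕ → Set
  PathPair m = Σ[ v ∈ (Fin (suc m) → V) ] Σ[ u ∈ (Fin (suc m) → V) ]
    Injective _≡_ _≡_ v × Injective _≡_ _≡_ u × u 0F ≡ v 0F × IsPath v × HasOneBackwardArc u

  pairBy : (g : Fin (suc m) → V) → Injective _≡_ _≡_ g → (ρ π : Fin (suc m) → Fin (suc m)) →
           {_ : True (injective? ρ)} {_ : True (injective? π)} →
           π 0F ≡ ρ 0F → IsPath (g ∘ ρ) → HasOneBackwardArc (g ∘ π) → PathPair m
  pairBy g g-inj ρ π {ρ-inj} {π-inj} π₀≡ρ₀ p h =
    g ∘ ρ , g ∘ π , toWitness ρ-inj ∘ g-inj , toWitness π-inj ∘ g-inj , cong g π₀≡ρ₀ , p , h

  fiveVertices : (g : Fin 5 → V) → Injective _≡_ _≡_ g → IsPath g → PathPair 4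
  fiveVertices g g-inj (a01 , a12 , a23 , a34 , tt)
    with orient g g-inj 2F 4F | orient g g-inj 0F 3F
  ... | inj₁ a24 | _        =
    pairBy g g-inj (0F ∷ 1F ∷ 2F ∷ 3F ∷ 4F ∷ []) (0F ∷ 1F ∷ 2F ∷ 4F ∷ 3F ∷ []) refl
      (a01 , a12 , a23 , a34 , tt) (inj₁ (a01 , inj₁ (a12 , inj₁ (a24 , inj₂ (a34 , tt)))))
  ... | inj₂ a42 | inj₁ a03 =
    pairBy g g-inj (0F ∷ 1F ∷ 2F ∷ 3F ∷ 4F ∷ []) (0F ∷ 3F ∷ 4F ∷ 2F ∷ 1F ∷ []) refl
      (a01 , a12 , a23 , a34 , tt) (inj₁ (a03 , inj₁ (a34 , inj₁ (a42 , inj₂ (a12 , tt)))))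
  ... | inj₂ a42 | inj₂ a30 =
    pairBy g g-inj (4F ∷ 2F ∷ 3F ∷ 0F ∷ 1F ∷ []) (4F ∷ 3F ∷ 0F ∷ 1F ∷ 2F ∷ []) refl
      (a42 , a23 , a30 , a01 , tt) (inj₂ (a34 , a30 , a01 , a12 , tt))

  pathPair : 4 ≤ m → (g : Fin (suc m) → V) → Injective _≡_ _≡_ g → IsPath g → PathPair m
  pathPair (s≤s (s≤s (s≤s (s≤s {n = zero} z≤n))))  = fiveVertices
  pathPair (s≤s (s≤s (s≤s (s≤s {n = suc k} z≤n)))) g g-inj path =
    let π , π-inj , π₀≡0 , h = oneBackwardReordering k g g-inj path
    in g , g ∘ π , g-inj , π-inj ∘ g-inj , cong g π₀≡0 , path , h

proposition3p6 : (m : ℕ) → 4 ≤ m → (T : Tournament (suc m)) →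
    let open Tournament T in
    ∃[ v ] ∃[ u ] (IsVertexOrdering v × IsVertexOrdering u × u zero ≡ v zero
      × (∀ (i : Fin m) → E (v (inject₁ i)) (v (fsuc i)))
      × ∃[ j ] (E (u (fsuc j)) (u (inject₁ j))
        × (∀ (i : Fin m) → ¬ i ≡ j → E (u (inject₁ i)) (u (fsuc i)))))
proposition3p6 m 4≤m T =
  let σ , σ-path = hamiltonPath id (λ eq → eq)
      v , u , v-inj , u-inj , u₀≡v₀ , v-path , u-one =
        pathPair 4≤m (σ ⟨$⟩ʳ_) (Injection.injective (↔⇒↣ σ)) σ-path
  in v , u , v-inj , u-inj , u₀≡v₀ ,
     IsPath⇒forward v v-path , HasOneBackwardArc⇒backwardOnlyAt u u-one
  where open Semicomplete (Tournament.E T) (Tournament.total T)
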